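{- Let $M=\langle W,\mathcal{N},\leq,V\rangle$ be the canonical model for $\mathbf{WWW}$, where for each $w\in W$, $n_w=\{\widehat{\varphi}:\mathsf{W}\varphi\in w\}$ and $\mathcal{N}_w=\{X\subseteq W:\text{there is }Y\in n_w\text{ with }Y\subseteq X\}$. Then $M$ is a $\mathsf{WWW}$-PN-model.
   Context: Formulas are built from a countable set $PV$ of propositional variables and $\bot$ by $\land,\lor,\rightarrow$ and a unary modal operator $\mathsf{W}$; $\lnot\varphi$ abbreviates $\varphi\to\bot$, $\varphi\leftrightarrow\psi$ abbreviates $(\varphi\to\psi)\land(\psi\to\varphi)$. The logic $\mathbf{WWW}$ is the smallest set of formulas containing all instances of the axiom schemes of intuitionistic propositional logic and all instances of $\mathsf{W}\varphi\to\lnot\varphi$, closed under modus ponens, the rule "from $\varphi\leftrightarrow\psi$ infer $\mathsf{W}\varphi\leftrightarrow\mathsf{W}\psi$", and the rule "from $\varphi\to\psi$ infer $(\mathsf{W}\varphi\land\lnot\psi)\to\mathsf{W}\psi$". A prime theory of $\mathbf{WWW}$ is a set $w$ of formulas with $\mathbf{WWW}\subseteq w$, closed under modus ponens, $\bot\notin w$, and $\varphi\lor\psi\in w$ implies $\varphi\in w$ or $\psi\in w$. The canonical model: $W$ = all prime theories of $\mathbf{WWW}$, $w\leq v$ iff $w\subseteq v$, $V(q)=\{w:q\in w\}$, $\widehat{\varphi}=\{z\in W:\varphi\in z\}$. A $\mathsf{WWW}$-PN-model is a quadruple $\langle W,\mathcal{N},\leq,V\rangle$ with $\leq$ a partial order,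 $\mathcal{N}:W\to P(P(W))$, $V:PV\to P(W)$ with each $V(q)$ upward closed, such that (i) if $w\leq v$, $X\in\mathcal{N}_w$ and $v\notin X$ then $X\in\mathcal{N}_v$; and (ii) if $X\in\mathcal{N}_w$ and $X\subseteq Y\subseteq W$ then $Y\in\mathcal{N}_w$. -}

module Defs where

open import Level using (Level; _⊔_; suc; zero)
open import Data.Nat using (ℕ)
open import Data.Product using (Σ; _×_; ∃; ∃-syntax; _,_)
open import Data.Sum using (_⊎_)
open import Data.Empty using (⊥)
open import Relation.Nullary using (¬_)
open import Relation.Binary using (Rel; IsPartialOrder)

infixr 4 _⇒_
infixr 5 _∨′_
infixr 6 _∧′_

data Form : Set where
  var  : ℕ → Form
  ⊥′   : Form
  _∧′_ : Form → Form → Form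
  _∨′_ : Form → Form → Form
  _⇒_  : Form → Form → Form
  𝖶    : Form → Form

¬′_ : Form → Form
¬′ φ = φ ⇒ ⊥′

_⇔′_ : Form → Form → Form
φ ⇔′ ψ = (φ ⇒ ψ) ∧′ (ψ ⇒ φ)

data IPCAxiom : Form → Set where
  K    : ∀ φ ψ → IPCAxiom (φ ⇒ ψ ⇒ φ)
  S    : ∀ φ ψ χ → IPCAxiom ((φ ⇒ ψ ⇒ χ) ⇒ (φ ⇒ ψ) ⇒ φ ⇒ χ)
  ∧E₁  : ∀ φ ψ → IPCAxiom (φ ∧′ ψ ⇒ φ)
  ∧E₂  : ∀ φ ψ → IPCAxiom (φ ∧′ ψ ⇒ ψ)
  ∧I   : ∀ φ ψ → IPCAxiom (φ ⇒ ψ ⇒ φ ∧′ ψ)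
  ∨I₁  : ∀ φ ψ → IPCAxiom (φ ⇒ φ ∨′ ψ)
  ∨I₂  : ∀ φ ψ → IPCAxiom (ψ ⇒ φ ∨′ ψ)
  ∨E   : ∀ φ ψ χ → IPCAxiom ((φ ⇒ χ) ⇒ (ψ ⇒ χ) ⇒ (φ ∨′ ψ ⇒ χ))
  efq  : ∀ φ → IPCAxiom (⊥′ ⇒ φ)

data WWW : Form → Set where
  ipc   : ∀ {φ} → IPCAxiom φ → WWW φ
  wax   : ∀ φ → WWW (𝖶 φ ⇒ ¬′ φ)
  mp    : ∀ {φ ψ} → WWW (φ ⇒ ψ) → WWW φ → WWW ψ
  re    : ∀ {φ ψ} → WWW (φ ⇔′ ψ) → WWW (𝖶 φ ⇔′ 𝖶 ψ)
  mono  : ∀ {φ ψ} → WWW (φ ⇒ ψ) → WWW ((𝖶 φ ∧′ ¬′ ψ) ⇒ 𝖶 ψ)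

FormSet : Set₁
FormSet = Form → Set

record IsPrimeTheory (w : FormSet) : Set where
  field
    contains-WWW : ∀ {φ} → WWW φ → w φ
    closed-mp    : ∀ {φ ψ} → w (φ ⇒ ψ) → w φ → w ψ
    consistent   : ¬ w ⊥′
    prime        : ∀ {φ ψ} → w (φ ∨′ ψ) → w φ ⊎ w ψ

-- Worlds carry an equivalence _≈_ (for the
-- canonical model: equality of prime theories as sets, i.e. mutual
-- inclusion), w.r.t. which ≤ is a partial order.

record IsPNModel {a e r n p v : Level} (W : Set a) (_≈_ : Rel W e)
                 (𝒩 : W → (W → Set p) → Set n) (_≤_ : Rel W r)
                 (V : ℕ → W → Set v)
                 : Set (a ⊔ e ⊔ r ⊔ n ⊔ suc p ⊔ v) where
  field
    isPartialOrder : IsPartialOrder _≈_ _≤_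
    V-upward       : ∀ q {w u} → w ≤ u → V q w → V q u
    cond-i         : ∀ {w u} {X : W → Set p} → w ≤ u → 𝒩 w X → ¬ X u → 𝒩 u X
    cond-ii        : ∀ {w} {X Y : W → Set p} → 𝒩 w X → (∀ z → X z → Y z) → 𝒩 w Y

CW : Set₁
CW = Σ FormSet IsPrimeTheory

thy : CW → FormSet
thy (w , _) = w

_≤c_ : CW → CW → Set
w ≤c u = ∀ φ → thy w φ → thy u φ

_≈c_ : CW → CW → Set
w ≈c u = (w ≤c u) × (u ≤c w)

Vc : ℕ → CW → Set
Vc q w = thy w (var q)

hat : Form → CW → Set
hat φ z = thy z φ

-- n_w = { φ̂ : 𝖶φ ∈ w }   (Y ∈ n_w iff Y = φ̂ as sets for some 𝖶φ ∈ w)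
n : CW → (CW → Set) → Set₁
n w Y = ∃[ φ ] (thy w (𝖶 φ) × (∀ z → (Y z → hat φ z) × (hat φ z → Y z)))

𝒩c : CW → (CW → Set) → Set₁
𝒩c w X = ∃[ Y ] (n w Y × (∀ z → Y z → X z))

{-# OPTIONS --safe #-}
module Submission where

open import Defs
open import Data.Product using (_,_; proj₁)
open import Function using (id; _∘_)
open import Relation.Binary using (IsPartialOrder; IsEquivalence)

-- Everything is inclusion of theories: ≤ is set inclusion, and n_w only grows
-- along ≤ because 𝖶φ ∈ w stays in every larger theory. Hence condition (i)
-- holds without its hypothesis v ∉ X.

≤c-refl : ∀ {w} → w ≤c w
≤c-refl φ = id

≤c-trans : ∀ {w u v} → w ≤c u → u ≤c v → w ≤c v
≤c-trans w≤u u≤v φ = u≤v φ ∘ w≤u φ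

-- Worlds are passed explicitly below: _≤c_ unfolds to a Π-type over formulas,
-- from which Agda cannot recover the worlds.
≈c-isEquivalence : IsEquivalence _≈c_
≈c-isEquivalence = record
  { refl  = λ {w} → ≤c-refl {w} , ≤c-refl {w}
  ; sym   = λ { (w≤u , u≤w) → u≤w , w≤u }
  ; trans = λ { {w} {u} {v} (w≤u , u≤w) (u≤v , v≤u) →
                  ≤c-trans {w} {u} {v} w≤u u≤v , ≤c-trans {v} {u} {w} v≤u u≤w }
  }

≤c-isPartialOrder : IsPartialOrder _≈c_ _≤c_
≤c-isPartialOrder = record
  { isPreorder = record
    { isEquivalence = ≈c-isEquivalence
    ; reflexive     = proj₁
    ; trans         = λ {w} {u} {v} → ≤c-trans {w} {u} {v}
    }
  ; antisym = _,_
  }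

Vc-upward : ∀ q {w u} → w ≤c u → Vc q w → Vc q u
Vc-upward q w≤u = w≤u (var q)

n-mono : ∀ {w u Y} → w ≤c u → n w Y → n u Y
n-mono w≤u (φ , 𝖶φ∈w , Y≡φ̂) = φ , w≤u (𝖶 φ) 𝖶φ∈w , Y≡φ̂

𝒩c-mono : ∀ {w u X} → w ≤c u → 𝒩c w X → 𝒩c u X
𝒩c-mono {w} {u} w≤u (Y , Y∈n , Y⊆X) = Y , n-mono {w} {u} w≤u Y∈n , Y⊆X

𝒩c-upward-closed : ∀ {w} {X Z : CW → Set} → 𝒩c w X → (∀ z → X z → Z z) → 𝒩c w Z
𝒩c-upward-closed (Y , Y∈n , Y⊆X) X⊆Z = Y , Y∈n , λ z → X⊆Z z ∘ Y⊆X z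

mainTheorem8 : IsPNModel CW _≈c_ 𝒩c _≤c_ Vc
mainTheorem8 = record
  { isPartialOrder = ≤c-isPartialOrder
  ; V-upward       = Vc-upward
  ; cond-i         = λ {w} {u} w≤u X∈𝒩w _ → 𝒩c-mono {w} {u} w≤u X∈𝒩w
  ; cond-ii        = λ {w} → 𝒩c-upward-closed {w}
  }
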